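{- Let $m\ge 0$, let $\lambda$ be a partition and let $(\alpha,\beta)_{(m+j)\times j}$ be its $m$-Durfee rectangle symbol. If $m$ appears in the rank-set of $\lambda$, then either $j=0$, or $j\ge1$ and $\beta_1=j$. If the rank of $\lambda$ is at least $-m$, then either $j=0$, or $j\ge 1$ and $\ell(\beta)\le\ell(\alpha)$.
   Context: For a partition $\lambda=(\lambda_1\ge\cdots\ge\lambda_\ell>0)$, $\ell(\lambda)=\ell$, the rank is $\lambda_1-\ell$ (rank of the empty partition is $0$), and the rank-set is the infinite sequence $[-\lambda_1,\,1-\lambda_2,\,\ldots,\,j-\lambda_{j+1},\,\ldots,\,\ell-1-\lambda_\ell,\,\ell,\,\ell+1,\ldots]$. For a partition $\mu$, $\mu_i=0$ if $\mu$ has fewer than $i$ parts. Fix $m\ge0$. The $m$-Durfee rectangle of $\lambda$ is the largest rectangle with $m+j$ rows and $j$ columns contained in the Ferrers diagram of $\lambda$, i.e. $j$ is the largest integer such that $j=0$ or $\lambda_{m+j}\ge j$ (so $j=0$ iff $\ell(\lambda)\le m$). The $m$-Durfee rectangle symbol of $\lambda$ is $(\alpha,\beta)_{(m+j)\times j}$, where $\alpha$ is the partition formed by the lengths of the columns of the Ferrers diagram to the right of the rectangle, i.e. $\alpha_i=\lambda'_{j+i}$ with $\lambda'$ the conjugate partition, and $\beta=(\lambda_{m+j+1},\lambda_{m+j+2},\ldots)$ consists of the rows below the rectangle. (When $j=0$ the symbol is $(\lambda',\emptyset)_{m\times 0}$.) -}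

module Defs where

open import Data.Nat using (ℕ; zero; suc; _+_; _≤_; _<_; _≤?_)
open import Data.Integer as ℤ using (ℤ; +_)
open import Data.List using (List; []; _∷_; length; filter; applyUpTo; drop)
open import Data.List.Relation.Unary.All using (All)
open import Data.List.Relation.Unary.Linked using (Linked)
open import Data.Product using (Σ; ∃; _×_)
open import Data.Sum using (_⊎_)
open import Relation.Binary.PropositionalEquality using (_≡_)
open import Relation.Nullary using (¬_)

IsPartition : List ℕ → Set
IsPartition p = Linked (λ a b → b ≤ a) p × All (λ x → 0 < x) p

-- part p i = λ_i (1-indexed), and 0 if p has fewer than i parts.
part : List ℕ → ℕ → ℕ
part []       _             = 0
part (x ∷ xs) zero          = 0
part (x ∷ xs) (suc zero)    = x
part (x ∷ xs) (suc (suc i)) = part xs (suc i)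

len : List ℕ → ℕ
len = length

rank : List ℕ → ℤ
rank p = + part p 1 ℤ.- + len p

-- m belongs to the rank-set [−λ₁, 1−λ₂, …, ℓ−1−λ_ℓ, ℓ, ℓ+1, …]
InRankSet : ℤ → List ℕ → Set
InRankSet r p =
  (Σ ℕ λ i → i < len p × (+ i ℤ.- + part p (suc i)) ≡ r)
  ⊎ (Σ ℕ λ k → len p ≤ k × + k ≡ r)

conj : List ℕ → List ℕ
conj p = applyUpTo (λ i → length (filter (λ x → suc i ≤? x) p)) (part p 1)

IsDurfee : ℕ → List ℕ → ℕ → Set
IsDurfee m p j =
  (j ≡ 0 ⊎ j ≤ part p (m + j))
  × (∀ k → (k ≡ 0 ⊎ k ≤ part p (m + k)) → k ≤ j)

-- α : column lengths to the right of the (m+j)×j rectangle, α_i = λ'_{j+i}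
durα : List ℕ → ℕ → List ℕ
durα p j = drop j (conj p)

-- β : rows below the rectangle, (λ_{m+j+1}, λ_{m+j+2}, …)
durβ : ℕ → List ℕ → ℕ → List ℕ
durβ m p j = drop (m + j) p

-- The m-Durfee number j is characterised by a fixed point: since λ is weakly
-- decreasing, any t with λ_{m+t+1} = t is the largest t with t ≤ λ_{m+t}.
-- An entry i − λ_{i+1} = m of the rank-set with i < ℓ(λ) is exactly such a
-- fixed point t = λ_{i+1}, located at i = m + t, so j = t = λ_{m+j+1} = β₁;
-- an entry k ≥ ℓ(λ) forces ℓ(λ) ≤ m and hence j = 0.  For the second claim,
-- ℓ(β) = ℓ(λ) − (m + j) and ℓ(α) = λ₁ − j, so it suffices that ℓ(λ) ≤ m + λ₁.
module Submission where

open import Defs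
open import Data.Nat using (ℕ; _≤_)
open import Data.Integer as ℤ using (+_; -_)
open import Data.List using (List; length)
open import Data.Product using (_×_)
open import Data.Sum using (_⊎_)
open import Relation.Binary.PropositionalEquality using (_≡_)

open import Data.Nat using (zero; suc; _+_; _∸_; _<_; _≥_; z≤n; s≤s)
open import Data.Nat.Properties
import Data.Integer.Properties as ℤP
open import Data.Integer.Solver using (module +-*-Solver)
open import Data.List using ([]; _∷_; drop)
open import Data.List.Properties using (length-drop; length-applyUpTo)
open import Data.List.Relation.Unary.Linked as Linked using (Linked; [-]; _∷_)
open import Data.Product using (_,_)
open import Data.Sum using (inj₁; inj₂)
open import Relation.Binary.PropositionalEquality
  using (refl; sym; cong; subst; subst₂; module ≡-Reasoning)
open import Relation.Nullary using (¬_; contradiction)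
open import Function using (_∘_)

open +-*-Solver

m-n≡o⇒m≡o+n : ∀ a b m → + a ℤ.- + b ≡ + m → a ≡ m + b
m-n≡o⇒m≡o+n a b m eq = ℤP.+-injective (begin
  + a                    ≡⟨ solve 2 (λ x y → x := (x :- y) :+ y) refl (+ a) (+ b) ⟩
  (+ a ℤ.- + b) ℤ.+ + b  ≡⟨ cong (ℤ._+ + b) eq ⟩
  + (m + b)              ∎)
  where open ≡-Reasoning

-o≤m-n⇒n≤o+m : ∀ a b m → - (+ m) ℤ.≤ + a ℤ.- + b → b ≤ m + a
-o≤m-n⇒n≤o+m a b m h = ℤP.drop‿+≤+ (subst₂ ℤ._≤_ left right (ℤP.+-monoˡ-≤ (+ m ℤ.+ + b) h))
  where
  left : - (+ m) ℤ.+ (+ m ℤ.+ + b) ≡ + b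
  left = solve 2 (λ x y → (:- y) :+ (y :+ x) := x) refl (+ b) (+ m)
  right : (+ a ℤ.- + b) ℤ.+ (+ m ℤ.+ + b) ≡ + (m + a)
  right = solve 3 (λ x y z → (x :- y) :+ (z :+ y) := z :+ x) refl (+ a) (+ b) (+ m)

part-tail-1≤head : ∀ {x xs} → Linked _≥_ (x ∷ xs) → part xs 1 ≤ x
part-tail-1≤head [-]      = z≤n
part-tail-1≤head (x≥y ∷ _) = x≥y

part-antitone : ∀ {p i k} → Linked _≥_ p → suc i ≤ k → part p k ≤ part p (suc i)
part-antitone {[]}                           _ _         = z≤n
part-antitone {x ∷ xs} {zero}  {suc zero}    _ _         = ≤-refl
part-antitone {x ∷ xs} {zero}  {suc (suc k)} d _         =
  ≤-trans (part-antitone (Linked.tail d) (s≤s z≤n)) (part-tail-1≤head d)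
part-antitone {x ∷ xs} {suc i} {suc (suc k)} d (s≤s i<k) =
  part-antitone (Linked.tail d) i<k

part-beyond-length : ∀ p {i} → len p < i → part p i ≡ 0
part-beyond-length []                     _         = refl
part-beyond-length (x ∷ xs) {suc (suc i)} (s≤s ℓ<i) = part-beyond-length xs ℓ<i

part-drop : ∀ k p → part (drop k p) 1 ≡ part p (suc k)
part-drop zero    []       = refl
part-drop zero    (x ∷ p)  = refl
part-drop (suc k) []       = refl
part-drop (suc k) (x ∷ p)  = part-drop k p

length-conj : ∀ p → length (conj p) ≡ part p 1
length-conj p = length-applyUpTo _ (part p 1)

fixed-point-fits : ∀ {m p} t → Linked _≥_ p → part p (suc (m + t)) ≡ t →
                   t ≡ 0 ⊎ t ≤ part p (m + t)
fixed-point-fits         zero    _ _     = inj₁ refl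
fixed-point-fits {m} {p} (suc s) d fixed = inj₂ (begin
  suc s                    ≡⟨ fixed ⟨
  part p (suc (m + suc s)) ≤⟨ part-antitone d (s≤s (+-monoʳ-≤ m (n≤1+n s))) ⟩
  part p (suc (m + s))     ≡⟨ cong (part p) (+-suc m s) ⟨
  part p (m + suc s)       ∎)
  where open ≤-Reasoning

durfee-fixed-point : ∀ {m p j t} → Linked _≥_ p → IsDurfee m p j →
                     part p (suc (m + t)) ≡ t → j ≡ t
durfee-fixed-point {m} {p} {j} {t} d (j-fits , j-max) fixed =
  ≤-antisym (≮⇒≥ (t≮j j-fits)) (j-max t (fixed-point-fits t d fixed))
  where
  t≮j : j ≡ 0 ⊎ j ≤ part p (m + j) → ¬ (t < j)
  t≮j (inj₁ j≡0) t<j = n≮0 (subst (t <_) j≡0 t<j)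
  t≮j (inj₂ j≤λ) t<j = <⇒≱ t<j (begin
    j                     ≤⟨ j≤λ ⟩
    part p (m + j)        ≤⟨ part-antitone d (≤-trans (≤-reflexive (sym (+-suc m t))) (+-monoʳ-≤ m t<j)) ⟩
    part p (suc (m + t))  ≡⟨ fixed ⟩
    t                     ∎)
    where open ≤-Reasoning

durfee≡0-if-length≤m : ∀ {m p j} → len p ≤ m → IsDurfee m p j → j ≡ 0
durfee≡0-if-length≤m {j = zero}      _   _              = refl
durfee≡0-if-length≤m {j = suc j}     _   (inj₁ () , _)
durfee≡0-if-length≤m {m} {p} {suc j} ℓ≤m (inj₂ j≤λ , _) =
  contradiction (subst (suc j ≤_) (part-beyond-length p ℓ<m+1+j) j≤λ) n≮0
  where
  ℓ<m+1+j : len p < m + suc j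
  ℓ<m+1+j = ≤-<-trans ℓ≤m (m<m+n m (s≤s z≤n))

zero-or-positive : ∀ {P : Set} j → (0 < j → P) → j ≡ 0 ⊎ (1 ≤ j × P)
zero-or-positive zero    _ = inj₁ refl
zero-or-positive (suc j) f = inj₂ (s≤s z≤n , f (s≤s z≤n))

rankSet⇒β₁≡durfee : ∀ {m p j} → Linked _≥_ p → IsDurfee m p j → InRankSet (+ m) p →
                    j ≡ 0 ⊎ part (durβ m p j) 1 ≡ j
rankSet⇒β₁≡durfee {p = p} d dur (inj₂ (k , ℓ≤k , k≡m)) =
  inj₁ (durfee≡0-if-length≤m {p = p} (subst (len p ≤_) (ℤP.+-injective k≡m) ℓ≤k) dur)
rankSet⇒β₁≡durfee {m} {p} {j} d dur (inj₁ (i , _ , i-λ≡m)) = inj₂ (begin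
  part (drop (m + j) p) 1  ≡⟨ part-drop (m + j) p ⟩
  part p (suc (m + j))     ≡⟨ cong (λ t → part p (suc (m + t))) j≡t ⟩
  part p (suc (m + t))     ≡⟨ fixed ⟩
  t                        ≡⟨ j≡t ⟨
  j                        ∎)
  where
  open ≡-Reasoning
  t = part p (suc i)
  fixed : part p (suc (m + t)) ≡ t
  fixed = cong (part p ∘ suc) (sym (m-n≡o⇒m≡o+n i t m i-λ≡m))
  j≡t : j ≡ t
  j≡t = durfee-fixed-point d dur fixed

length-durβ≤length-durα : ∀ m p j → len p ≤ m + part p 1 → length (durβ m p j) ≤ length (durα p j)
length-durβ≤length-durα m p j ℓ≤m+λ₁ = begin
  length (drop (m + j) p)  ≡⟨ length-drop (m + j) p ⟩
  len p ∸ (m + j)          ≡⟨ ∸-+-assoc (len p) m j ⟨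
  len p ∸ m ∸ j            ≤⟨ ∸-monoˡ-≤ j (m≤n+o⇒m∸n≤o (len p) m ℓ≤m+λ₁) ⟩
  part p 1 ∸ j             ≡⟨ cong (_∸ j) (length-conj p) ⟨
  length (conj p) ∸ j      ≡⟨ length-drop j (conj p) ⟨
  length (drop j (conj p)) ∎
  where open ≤-Reasoning

proposition3p1 : (m : ℕ) (p : List ℕ) → IsPartition p → (j : ℕ) → IsDurfee m p j →
    (InRankSet (+ m) p → j ≡ 0 ⊎ (1 ≤ j × part (durβ m p j) 1 ≡ j))
    × ((- (+ m)) ℤ.≤ rank p → j ≡ 0 ⊎ (1 ≤ j × length (durβ m p j) ≤ length (durα p j)))
proposition3p1 m p (decreasing , _) j dur = first , second
  where
  first : InRankSet (+ m) p → j ≡ 0 ⊎ (1 ≤ j × part (durβ m p j) 1 ≡ j)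
  first m∈ranks with rankSet⇒β₁≡durfee decreasing dur m∈ranks
  ... | inj₁ j≡0 = inj₁ j≡0
  ... | inj₂ β₁≡j = zero-or-positive j (λ _ → β₁≡j)
  second : (- (+ m)) ℤ.≤ rank p → j ≡ 0 ⊎ (1 ≤ j × length (durβ m p j) ≤ length (durα p j))
  second rank≥-m = zero-or-positive j λ _ →
    length-durβ≤length-durα m p j (-o≤m-n⇒n≤o+m (part p 1) (len p) m rank≥-m)
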